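{- Let $d\ge 2$, $e\ge 1$, let $F=F_{\rm top}+F_0\in\mathbb{Z}[Y,X_1,X_2]$ where $F_{\rm top}=Y^d+Y^{d-1}f_1(X)+\cdots+f_d(X)$ is absolutely irreducible with each $f_i$ zero or homogeneous of degree $ei$, and $F_0(Y^e,X)$ has degree $<de$. Let $\ell\subset V(F)\subset\mathbb{A}^3$ be a twisted line over $\mathbb{Q}$ with $$\ell(\mathbb{Q})=\{(a_0+tw_1+\cdots+t^ew_e,\ a_1+tv_1,\ a_2+tv_2)\mid t\in\mathbb{Q}\},$$ where $a_0,a_1,a_2,w_1,\ldots,w_e\in\mathbb{Q}$, $v_1,v_2$ are coprime integers and $w_e$ is an integer. Then for $B\ge 1$, $$N_{\rm aff}(\ell;B^e,B,B)\le\frac{2eB}{\max\{|w_e|^{1/e},|v_1|,|v_2|\}}+e,$$ where $N_{\rm aff}(\ell;B^e,B,B)=\#\{(y,x_1,x_2)\in\ell\cap\mathbb{Z}^3: |y|\le B^e,|x_1|\le B,|x_2|\le B\}$.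
   Context: A twisted line on $V(F)$ over $\mathbb{Q}$ is a subvariety $\ell\subset V(F)$ defined over $\mathbb{Q}$ such that its image under the projection $(y,x_1,x_2)\mapsto(x_1,x_2)$ is a line in $\mathbb{A}^2$ and the projection restricted to $\ell$ is an isomorphism onto its image.
   Formalization: The parameter $B$ ranges over the rational numbers at least 1. -}

module Defs where

open import Level using (0ℓ)
open import Algebra.Bundles using (CommutativeRing)
open import Data.Nat as ℕ using (ℕ; zero; suc; _∸_)
open import Data.Integer as ℤ using (ℤ; +_; -[1+_])
open import Data.List using (List; []; _∷_; _++_; map)
open import Data.List.Relation.Unary.All using (All)
open import Data.Product using (Σ; ∃; _×_; _,_)
open import Data.Rational as ℚ using (ℚ; 0ℚ; 1ℚ)
open import Relation.Nullary using (¬_)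
open import Relation.Binary.PropositionalEquality using (_≡_)

-- Polynomials as finite lists of monomials (a representation; the
-- polynomial is the sum of its monomials).

record Mono3 (A : Set) : Set where
  constructor mono3
  field
    coeff : A
    degY  : ℕ
    deg1  : ℕ
    deg2  : ℕ
open Mono3 public

Poly3 : Set → Set
Poly3 A = List (Mono3 A)

-- c · X₁^b · X₂^k   represented as (c , b , k)
Poly2 : Set → Set
Poly2 A = List (A × ℕ × ℕ)

-- every monomial of the representation has total degree n
-- (an empty list is the zero polynomial)
HomogOfDeg : {A : Set} → ℕ → Poly2 A → Set
HomogOfDeg n p = All (λ { (c , b , k) → b ℕ.+ k ≡ n }) p

liftY : {A : Set} → ℕ → Poly2 A → Poly3 A
liftY k p = map (λ { (c , b , m) → mono3 c k b m }) p

lowerTerms : ℕ → (ℕ → Poly2 ℤ) → ℕ → Poly3 ℤ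
lowerTerms d f zero    = []
lowerTerms d f (suc i) = liftY (d ∸ suc i) (f (suc i)) ++ lowerTerms d f i

Ftop : ℕ → (ℕ → Poly2 ℤ) → Poly3 ℤ
Ftop d f = mono3 (+ 1) d 0 0 ∷ lowerTerms d f d

module OverRing (R : CommutativeRing 0ℓ 0ℓ) where
  open CommutativeRing R

  pow : Carrier → ℕ → Carrier
  pow x zero    = 1#
  pow x (suc n) = x * pow x n

  natR : ℕ → Carrier
  natR zero    = 0#
  natR (suc n) = 1# + natR n

  intR : ℤ → Carrier
  intR (+ n)      = natR n
  intR -[1+ n ]   = - natR (suc n)

  eval3 : Poly3 Carrier → Carrier → Carrier → Carrier → Carrier
  eval3 []                     y x₁ x₂ = 0#
  eval3 (mono3 c a b k ∷ p) y x₁ x₂ =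
    c * pow y a * pow x₁ b * pow x₂ k + eval3 p y x₁ x₂

  evalℤ3 : Poly3 ℤ → Carrier → Carrier → Carrier → Carrier
  evalℤ3 []                     y x₁ x₂ = 0#
  evalℤ3 (mono3 c a b k ∷ p) y x₁ x₂ =
    intR c * pow y a * pow x₁ b * pow x₂ k + evalℤ3 p y x₁ x₂

  sumPow : ℕ → (ℕ → Carrier) → Carrier → Carrier
  sumPow zero    c x = 0#
  sumPow (suc n) c x = c n * pow x n + sumPow n c x

  NonConstant : (Carrier → Carrier → Carrier → Carrier) → Set
  NonConstant g = ∃ λ y → ∃ λ x₁ → ∃ λ x₂ → ∃ λ y' → ∃ λ x₁' → ∃ λ x₂' →
    ¬ (g y x₁ x₂ ≈ g y' x₁' x₂')

record IsAlgClosedChar0Field (R : CommutativeRing 0ℓ 0ℓ) : Set where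
  open CommutativeRing R
  open OverRing R
  field
    inverse   : ∀ x → ¬ (x ≈ 0#) → ∃ λ y → x * y ≈ 1#
    char0     : ∀ n → ¬ (natR (suc n) ≈ 0#)
    algClosed : ∀ (n : ℕ) (c : ℕ → Carrier) →
                ∃ λ x → pow x (suc n) + sumPow (suc n) c x ≈ 0#

-- p ∈ ℤ[Y,X₁,X₂] is irreducible over the field K: non-constant and not a
-- product of two non-constant polynomials over K.  (K is infinite, so
-- equality / non-constancy of polynomial functions agree with those of
-- polynomials.)
IrreducibleOver : (K : CommutativeRing 0ℓ 0ℓ) → Poly3 ℤ → Set
IrreducibleOver K p =
  NonConstant (evalℤ3 p) ×
  ¬ (Σ (Poly3 Carrier) λ G → Σ (Poly3 Carrier) λ H →
       NonConstant (eval3 G) × NonConstant (eval3 H) ×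
       (∀ y x₁ x₂ → evalℤ3 p y x₁ x₂ ≈ eval3 G y x₁ x₂ * eval3 H y x₁ x₂))
  where
  open CommutativeRing K
  open OverRing K

-- absolutely irreducible: irreducible over every algebraically closed field
-- of characteristic 0 (equivalently over ℚ̄)
AbsIrreducible : Poly3 ℤ → Set₁
AbsIrreducible p =
  (K : CommutativeRing 0ℓ 0ℓ) → IsAlgClosedChar0Field K → IrreducibleOver K p

ℤtoℚ : ℤ → ℚ
ℤtoℚ z = z ℚ./ 1

ℕtoℚ : ℕ → ℚ
ℕtoℚ n = ℤtoℚ (+ n)

powℚ : ℚ → ℕ → ℚ
powℚ x zero    = 1ℚ
powℚ x (suc n) = x ℚ.* powℚ x n

sumTW : ℕ → (ℕ → ℚ) → ℚ → ℚ
sumTW zero    w t = 0ℚ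
sumTW (suc n) w t = sumTW n w t ℚ.+ powℚ t (suc n) ℚ.* w (suc n)

yCoord : ℕ → ℚ → (ℕ → ℚ) → ℤ → ℚ → ℚ
yCoord e a₀ w wₑ t = a₀ ℚ.+ sumTW (e ∸ 1) w t ℚ.+ powℚ t e ℚ.* ℤtoℚ wₑ

xCoord : ℚ → ℤ → ℚ → ℚ
xCoord a v t = a ℚ.+ t ℚ.* ℤtoℚ v

OnLine : ℕ → ℚ → ℚ → ℚ → (ℕ → ℚ) → ℤ → ℤ → ℤ → ℤ × ℤ × ℤ → Set
OnLine e a₀ a₁ a₂ w wₑ v₁ v₂ (y , x₁ , x₂) = ∃ λ t →
  (ℤtoℚ y ≡ yCoord e a₀ w wₑ t) ×
  (ℤtoℚ x₁ ≡ xCoord a₁ v₁ t) ×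
  (ℤtoℚ x₂ ≡ xCoord a₂ v₂ t)

InBox : ℕ → ℚ → ℤ × ℤ × ℤ → Set
InBox e B (y , x₁ , x₂) =
  (ℚ.∣ ℤtoℚ y ∣ ℚ.≤ powℚ B e) × (ℚ.∣ ℤtoℚ x₁ ∣ ℚ.≤ B) × (ℚ.∣ ℤtoℚ x₂ ∣ ℚ.≤ B)

-- N ≤ 2eB / max{|w_e|^{1/e}, |v₁|, |v₂|} + e, written without e-th roots or
-- division: with k = N ∸ e and c = 2eB,
--   k·|v₁| ≤ c,  k·|v₂| ≤ c,  k^e·|w_e| ≤ c^e.
-- (If N ≤ e both sides are trivially true; if N > e, then k > 0 and
-- k ≤ c / M  ⇔  k·m ≤ c for each m among the three quantities, and
-- k·|w_e|^{1/e} ≤ c ⇔ k^e |w_e| ≤ c^e as both sides are ≥ 0.)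
CountBound : ℕ → ℚ → ℤ → ℤ → ℤ → ℕ → Set
CountBound e B wₑ v₁ v₂ N =
  (ℕtoℚ k ℚ.* ℚ.∣ ℤtoℚ v₁ ∣ ℚ.≤ c) ×
  (ℕtoℚ k ℚ.* ℚ.∣ ℤtoℚ v₂ ∣ ℚ.≤ c) ×
  (powℚ (ℕtoℚ k) e ℚ.* ℚ.∣ ℤtoℚ wₑ ∣ ℚ.≤ powℚ c e)
  where
  k : ℕ
  k = N ∸ e
  c : ℚ
  c = ℕtoℚ (2 ℕ.* e) ℚ.* B

{-# OPTIONS --safe #-}
-- Since v₁ and v₂ are coprime, a Bézout relation α v₁ + β v₂ = 1 shows that the parameters t of
-- the integer points of ℓ differ by integers; sorted, they are spaced at least 1 apart.  If a
-- polynomial g of degree n with leading coefficient L satisfies |g| ≤ M at more than n h such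
-- points, then hⁿ |L| ≤ 2ⁿ M: if s is the smallest point, more than (n - 1) h of the points lie at
-- distance ≥ h to the right of s, and at those points h (g t - g s) / (t - s), a polynomial of
-- degree n - 1 with leading coefficient h L, is bounded by 2M.  For N points and h = ⌊(N - 1)/n⌋
-- this gives (N - n)ⁿ |L| ≤ (2n)ⁿ M, which yields the claimed bound for the x-coordinates
-- (n = 1, M = B) and for the y-coordinate (n = e, M = Bᵉ).
module Submission where

open import Defs
open import Data.Integer as ℤ using (ℤ; +_; -[1+_]; 1ℤ; -1ℤ)
import Data.Integer.Properties as ℤ
open import Data.Integer.Coprimality using (Coprime)
import Data.Integer.Solver as ℤ-Solver
open import Data.Nat as ℕ using (ℕ; zero; suc)
import Data.Nat.Properties as ℕ
import Data.Nat.Coprimality as ℕ-Coprimality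
open import Data.Nat.DivMod using (_/_; _%_; m≡m%n+[m/n]*n; m%n<n; m/n*n≤m)
open import Data.Nat.GCD using (module Bézout)
open import Data.Rational using (ℚ; 0ℚ; 1ℚ)
import Data.Rational as ℚ
import Data.Rational.Properties as ℚ
open import Data.Rational.Properties using (+-*-commutativeRing)
open import Data.Rational.Solver using (module +-*-Solver)
open import Data.List using (List; []; _∷_; length; map; drop; _++_)
open import Data.List.Properties using (length-map; length-drop)
open import Data.List.Relation.Unary.All as All using (All; []; _∷_)
import Data.List.Relation.Unary.All.Properties as All
open import Data.List.Relation.Unary.Linked as Linked using (Linked; []; [-]; _∷_)
import Data.List.Relation.Unary.Linked.Properties as Linked
open import Data.List.Relation.Unary.Unique.Propositional using (Unique; []; _∷_)
open import Data.List.Relation.Binary.Permutation.Propositional using (↭-sym; ↭⇒↭ₛ)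
open import Data.List.Relation.Binary.Permutation.Propositional.Properties
  using (All-resp-↭; ↭-length)
open import Data.Vec as Vec using (Vec; []; _∷_; _∷ʳ_)
open import Data.Product using (∃; ∃₂; _×_; _,_; proj₁; proj₂)
open import Data.Sum using (inj₁; inj₂)
open import Function using (_∘_)
open import Relation.Binary.PropositionalEquality as ≡
  using (_≡_; refl; sym; trans; cong; cong₂; subst; subst₂)
open import Data.List.Relation.Binary.Permutation.Setoid.Properties (≡.setoid ℤ)
  using (Unique-resp-↭)
open import Data.List.Sort ℤ.≤-decTotalOrder using (sort; sort-↭; sort-↗)
open OverRing +-*-commutativeRing using (evalℤ3)

Unique-map⁺-on : ∀ {A B : Set} {P : A → Set} {f : A → B} → (∀ {x y} → P x → P y → f x ≡ f y → x ≡ y) →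
                 ∀ {xs} → All P xs → Unique xs → Unique (map f xs)
Unique-map⁺-on inj []         []       = []
Unique-map⁺-on inj (px ∷ pxs) (x∉ ∷ u) =
  All.map⁺ (All.zipWith (λ (x≢y , py) → x≢y ∘ inj px py) (x∉ , pxs)) ∷ Unique-map⁺-on inj pxs u

Linked-drop⁺ : ∀ {A : Set} {R : A → A → Set} n {xs} → Linked R xs → Linked R (drop n xs)
Linked-drop⁺ zero    l       = l
Linked-drop⁺ (suc n) []      = []
Linked-drop⁺ (suc n) [-]     = Linked-drop⁺ n []
Linked-drop⁺ (suc n) (_ ∷ l) = Linked-drop⁺ n l

sort-strictlyIncreasing : ∀ {zs} → Unique zs → Linked ℤ._<_ (sort zs)
sort-strictlyIncreasing {zs} u = Linked.zipWith (λ (≤ , ≢) → ℤ.≤∧≢⇒< ≤ ≢)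
  (sort-↗ zs , Linked.AllPairs⇒Linked (Unique-resp-↭ (↭⇒↭ₛ (↭-sym (sort-↭ zs))) u))

suc[m]∸n≤m/n*n : ∀ m n .{{_ : ℕ.NonZero n}} → suc m ℕ.∸ n ℕ.≤ m / n ℕ.* n
suc[m]∸n≤m/n*n m n = ℕ.m≤n+o⇒m∸n≤o (suc m) n (begin
  suc m                       ≡⟨ cong suc (m≡m%n+[m/n]*n m n) ⟩
  suc (m % n ℕ.+ m / n ℕ.* n) ≤⟨ ℕ.+-monoˡ-≤ (m / n ℕ.* n) (m%n<n m n) ⟩
  n ℕ.+ m / n ℕ.* n           ∎)
  where open ℕ.≤-Reasoning

∣i∣≡s*i : ∀ i → ∃ λ s → + ℤ.∣ i ∣ ≡ s ℤ.* i
∣i∣≡s*i i with ℤ.+∣i∣≡i⊎+∣i∣≡-i i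
... | inj₁ ∣i∣≡i  = 1ℤ  , trans ∣i∣≡i (sym (ℤ.*-identityˡ i))
... | inj₂ ∣i∣≡-i = -1ℤ , trans ∣i∣≡-i (sym (ℤ.-1*i≡-i i))

bézout-ℕ⇒ℤ : ∀ {i j} x y → 1 ℕ.+ y ℕ.* ℤ.∣ j ∣ ≡ x ℕ.* ℤ.∣ i ∣ →
             ∃₂ λ α β → α ℤ.* i ℤ.+ β ℤ.* j ≡ 1ℤ
bézout-ℕ⇒ℤ {i} {j} x y eq with ∣i∣≡s*i i | ∣i∣≡s*i j
... | s , ∣i∣≡si | r , ∣j∣≡rj = + x ℤ.* s , ℤ.- (+ y ℤ.* r) , (begin
  (+ x ℤ.* s) ℤ.* i ℤ.+ ℤ.- (+ y ℤ.* r) ℤ.* j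
    ≡⟨ solve 6 (λ x y s r i j → (x :* s) :* i :+ :- (y :* r) :* j := x :* (s :* i) :- y :* (r :* j))
               refl (+ x) (+ y) s r i j ⟩
  + x ℤ.* (s ℤ.* i) ℤ.- + y ℤ.* (r ℤ.* j)
    ≡⟨ cong₂ (λ a b → + x ℤ.* a ℤ.- + y ℤ.* b) (sym ∣i∣≡si) (sym ∣j∣≡rj) ⟩
  + x ℤ.* + ℤ.∣ i ∣ ℤ.- + y ℤ.* + ℤ.∣ j ∣
    ≡⟨ cong₂ ℤ._-_ (sym (ℤ.pos-* x ℤ.∣ i ∣)) (sym (ℤ.pos-* y ℤ.∣ j ∣)) ⟩
  + (x ℕ.* ℤ.∣ i ∣) ℤ.- + (y ℕ.* ℤ.∣ j ∣)
    ≡⟨ cong (λ k → + k ℤ.- + (y ℕ.* ℤ.∣ j ∣)) (sym eq) ⟩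
  (1ℤ ℤ.+ + (y ℕ.* ℤ.∣ j ∣)) ℤ.- + (y ℕ.* ℤ.∣ j ∣)
    ≡⟨ solve 1 (λ k → (con 1ℤ :+ k) :- k := con 1ℤ) refl (+ (y ℕ.* ℤ.∣ j ∣)) ⟩
  1ℤ ∎)
  where open ≡.≡-Reasoning
        open ℤ-Solver.+-*-Solver

bézout : ∀ {i j} → Coprime i j → ∃₂ λ α β → α ℤ.* i ℤ.+ β ℤ.* j ≡ 1ℤ
bézout {i} {j} c with ℕ-Coprimality.coprime-Bézout c
... | Bézout.+- x y eq = bézout-ℕ⇒ℤ x y eq
... | Bézout.-+ x y eq with bézout-ℕ⇒ℤ {j} {i} y x eq
...   | β , α , βj+αi≡1 = α , β , trans (ℤ.+-comm (α ℤ.* i) (β ℤ.* j)) βj+αi≡1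

module Casts where
  open import Data.Rational using (mkℚ; ↥_; _+_; _-_; _*_; -_; _≤_; *≤*)

  ℤtoℚ≡mkℚ : ∀ i → ℤtoℚ i ≡ mkℚ i 0 (ℕ-Coprimality.sym (ℕ-Coprimality.1-coprimeTo ℤ.∣ i ∣))
  ℤtoℚ≡mkℚ i = ℚ.↥p/↧p≡p (mkℚ i 0 (ℕ-Coprimality.sym (ℕ-Coprimality.1-coprimeTo ℤ.∣ i ∣)))

  ℤtoℚ-+ : ∀ i j → ℤtoℚ (i ℤ.+ j) ≡ ℤtoℚ i + ℤtoℚ j
  ℤtoℚ-+ i j rewrite ℤtoℚ≡mkℚ i | ℤtoℚ≡mkℚ j =
    cong₂ (λ a b → (a ℤ.+ b) ℚ./ 1) (sym (ℤ.*-identityʳ i)) (sym (ℤ.*-identityʳ j))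

  ℤtoℚ-* : ∀ i j → ℤtoℚ (i ℤ.* j) ≡ ℤtoℚ i * ℤtoℚ j
  ℤtoℚ-* i j rewrite ℤtoℚ≡mkℚ i | ℤtoℚ≡mkℚ j = refl

  ℤtoℚ-neg : ∀ i → ℤtoℚ (ℤ.- i) ≡ - ℤtoℚ i
  ℤtoℚ-neg i rewrite ℤtoℚ≡mkℚ i | ℤtoℚ≡mkℚ (ℤ.- i) with i
  ... | + zero   = refl
  ... | + suc n  = refl
  ... | -[1+ n ] = refl

  ℤtoℚ-- : ∀ i j → ℤtoℚ (i ℤ.- j) ≡ ℤtoℚ i - ℤtoℚ j
  ℤtoℚ-- i j = trans (ℤtoℚ-+ i (ℤ.- j)) (cong (_+_ (ℤtoℚ i)) (ℤtoℚ-neg j))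

  ℤtoℚ-linear : ∀ α x β y → ℤtoℚ (α ℤ.* x ℤ.+ β ℤ.* y) ≡ ℤtoℚ α * ℤtoℚ x + ℤtoℚ β * ℤtoℚ y
  ℤtoℚ-linear α x β y = trans (ℤtoℚ-+ (α ℤ.* x) (β ℤ.* y)) (cong₂ _+_ (ℤtoℚ-* α x) (ℤtoℚ-* β y))

  ↥-ℤtoℚ : ∀ i → ↥ ℤtoℚ i ≡ i
  ↥-ℤtoℚ i = cong ↥_ (ℤtoℚ≡mkℚ i)

  ℤtoℚ-injective : ∀ {i j} → ℤtoℚ i ≡ ℤtoℚ j → i ≡ j
  ℤtoℚ-injective {i} {j} eq = trans (sym (↥-ℤtoℚ i)) (trans (cong ↥_ eq) (↥-ℤtoℚ j))

  ℤtoℚ-mono-≤ : ∀ {i j} → i ℤ.≤ j → ℤtoℚ i ≤ ℤtoℚ j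
  ℤtoℚ-mono-≤ {i} {j} i≤j rewrite ℤtoℚ≡mkℚ i | ℤtoℚ≡mkℚ j =
    *≤* (subst₂ ℤ._≤_ (sym (ℤ.*-identityʳ i)) (sym (ℤ.*-identityʳ j)) i≤j)

  ℤtoℚ-<⇒1≤- : ∀ {i j} → i ℤ.< j → 1ℚ ≤ ℤtoℚ j - ℤtoℚ i
  ℤtoℚ-<⇒1≤- {i} {j} i<j = begin
    1ℚ                       ≡⟨ solve 1 (λ x → con 1ℚ := (con 1ℚ :+ x) :- x) refl (ℤtoℚ i) ⟩
    (1ℚ + ℤtoℚ i) - ℤtoℚ i   ≡⟨ cong (_- ℤtoℚ i) (sym (ℤtoℚ-+ 1ℤ i)) ⟩
    ℤtoℚ (1ℤ ℤ.+ i) - ℤtoℚ i ≤⟨ ℚ.+-monoˡ-≤ (- ℤtoℚ i) (ℤtoℚ-mono-≤ (ℤ.i<j⇒suc[i]≤j i<j)) ⟩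
    ℤtoℚ j - ℤtoℚ i          ∎
    where open ℚ.≤-Reasoning
          open +-*-Solver

  ℕtoℚ-* : ∀ m n → ℕtoℚ (m ℕ.* n) ≡ ℕtoℚ m * ℕtoℚ n
  ℕtoℚ-* m n = trans (cong ℤtoℚ (ℤ.pos-* m n)) (ℤtoℚ-* (+ m) (+ n))

  ℕtoℚ-suc : ∀ n → ℕtoℚ (suc n) ≡ 1ℚ + ℕtoℚ n
  ℕtoℚ-suc n = ℤtoℚ-+ 1ℤ (+ n)

  ℕtoℚ-mono-≤ : ∀ {m n} → m ℕ.≤ n → ℕtoℚ m ≤ ℕtoℚ n
  ℕtoℚ-mono-≤ m≤n = ℤtoℚ-mono-≤ (ℤ.+≤+ m≤n)

  0≤ℕtoℚ : ∀ n → 0ℚ ≤ ℕtoℚ n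
  0≤ℕtoℚ n = ℕtoℚ-mono-≤ {0} {n} ℕ.z≤n

  bézout-integral : ∀ α β v₁ v₂ δ₁ δ₂ {d} → α ℤ.* v₁ ℤ.+ β ℤ.* v₂ ≡ 1ℤ →
                    ℤtoℚ δ₁ ≡ d * ℤtoℚ v₁ → ℤtoℚ δ₂ ≡ d * ℤtoℚ v₂ →
                    d ≡ ℤtoℚ (α ℤ.* δ₁ ℤ.+ β ℤ.* δ₂)
  bézout-integral α β v₁ v₂ δ₁ δ₂ {d} bez δ₁≡dv₁ δ₂≡dv₂ = begin
    d                            ≡⟨ sym (ℚ.*-identityʳ d) ⟩
    d * 1ℚ                       ≡⟨ cong (_*_ d) (trans (cong ℤtoℚ (sym bez)) (ℤtoℚ-linear α v₁ β v₂)) ⟩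
    d * (A * V₁ + B * V₂)        ≡⟨ solve 5 (λ d A V₁ B V₂ → d :* (A :* V₁ :+ B :* V₂) :=
                                               A :* (d :* V₁) :+ B :* (d :* V₂)) refl d A V₁ B V₂ ⟩
    A * (d * V₁) + B * (d * V₂)  ≡⟨ cong₂ (λ x y → A * x + B * y) (sym δ₁≡dv₁) (sym δ₂≡dv₂) ⟩
    A * ℤtoℚ δ₁ + B * ℤtoℚ δ₂    ≡⟨ sym (ℤtoℚ-linear α δ₁ β δ₂) ⟩
    ℤtoℚ (α ℤ.* δ₁ ℤ.+ β ℤ.* δ₂) ∎
    where
    open ≡.≡-Reasoning
    open +-*-Solver
    A = ℤtoℚ α
    B = ℤtoℚ β
    V₁ = ℤtoℚ v₁
    V₂ = ℤtoℚ v₂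

open Casts

module Powers where
  open import Data.Rational using (_*_; _≤_)

  *-nonNeg : ∀ {p q} → 0ℚ ≤ p → 0ℚ ≤ q → 0ℚ ≤ p * q
  *-nonNeg {p} {q} 0≤p 0≤q =
    ℚ.nonNegative⁻¹ _ {{ℚ.nonNeg*nonNeg⇒nonNeg p {{ℚ.nonNegative 0≤p}} q {{ℚ.nonNegative 0≤q}}}}

  *-mono-≤-nonNeg : ∀ {p q r s} → 0ℚ ≤ p → 0ℚ ≤ r → p ≤ q → r ≤ s → p * r ≤ q * s
  *-mono-≤-nonNeg {p} {q} {r} {s} 0≤p 0≤r p≤q r≤s = ℚ.≤-trans
    (ℚ.*-monoˡ-≤-nonNeg p {{ℚ.nonNegative 0≤p}} r≤s)
    (ℚ.*-monoʳ-≤-nonNeg s {{ℚ.nonNegative (ℚ.≤-trans 0≤r r≤s)}} p≤q)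

  powℚ-nonNeg : ∀ {p} n → 0ℚ ≤ p → 0ℚ ≤ powℚ p n
  powℚ-nonNeg zero    0≤p = ℚ.nonNegative⁻¹ 1ℚ
  powℚ-nonNeg (suc n) 0≤p = *-nonNeg 0≤p (powℚ-nonNeg n 0≤p)

  powℚ-mono-≤ : ∀ {p q} n → 0ℚ ≤ p → p ≤ q → powℚ p n ≤ powℚ q n
  powℚ-mono-≤ zero    0≤p p≤q = ℚ.≤-refl
  powℚ-mono-≤ (suc n) 0≤p p≤q =
    *-mono-≤-nonNeg 0≤p (powℚ-nonNeg n 0≤p) p≤q (powℚ-mono-≤ n 0≤p p≤q)

  powℚ-distrib-* : ∀ p q n → powℚ (p * q) n ≡ powℚ p n * powℚ q n
  powℚ-distrib-* p q zero    = refl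
  powℚ-distrib-* p q (suc n) = begin
    (p * q) * powℚ (p * q) n        ≡⟨ cong (_*_ (p * q)) (powℚ-distrib-* p q n) ⟩
    (p * q) * (powℚ p n * powℚ q n) ≡⟨ solve 4 (λ p q a b → (p :* q) :* (a :* b) := (p :* a) :* (q :* b))
                                               refl p q (powℚ p n) (powℚ q n) ⟩
    (p * powℚ p n) * (q * powℚ q n) ∎
    where open ≡.≡-Reasoning
          open +-*-Solver

open Powers

module Horner where
  open import Data.Rational using (_+_; _-_; _*_)
  open ≡.≡-Reasoning
  open +-*-Solver

  -- horner (c₀ ∷ ⋯ ∷ cₙ₋₁) L t = c₀ + c₁ t + ⋯ + cₙ₋₁ tⁿ⁻¹ + L tⁿ, of degree n with leading coefficient L
  horner : ∀ {n} → Vec ℚ n → ℚ → ℚ → ℚ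
  horner []       L t = L
  horner (c ∷ cs) L t = c + t * horner cs L t

  quotient : ∀ {n} → ℚ → ℚ → Vec ℚ n → Vec ℚ n
  quotient u L []       = []
  quotient u L (c ∷ cs) = horner (c ∷ cs) L u ∷ quotient u L cs

  horner-factor : ∀ {n} c (cs : Vec ℚ n) L u t →
                  horner (c ∷ cs) L t - horner (c ∷ cs) L u ≡ (t - u) * horner (quotient u L cs) L t
  horner-factor c [] L u t =
    solve 4 (λ c L u t → (c :+ t :* L) :- (c :+ u :* L) := (t :- u) :* L) refl c L u t
  horner-factor c (c′ ∷ cs) L u t = begin
    (c + t * Ht) - (c + u * Hu)
      ≡⟨ solve 5 (λ c t u Ht Hu → (c :+ t :* Ht) :- (c :+ u :* Hu) := (t :- u) :* Hu :+ t :* (Ht :- Hu))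
                 refl c t u Ht Hu ⟩
    (t - u) * Hu + t * (Ht - Hu)
      ≡⟨ cong (λ d → (t - u) * Hu + t * d) (horner-factor c′ cs L u t) ⟩
    (t - u) * Hu + t * ((t - u) * Qt)
      ≡⟨ solve 4 (λ t u Hu Qt → (t :- u) :* Hu :+ t :* ((t :- u) :* Qt) := (t :- u) :* (Hu :+ t :* Qt))
                 refl t u Hu Qt ⟩
    (t - u) * (Hu + t * Qt) ∎
    where
    Ht = horner (c′ ∷ cs) L t
    Hu = horner (c′ ∷ cs) L u
    Qt = horner (quotient u L cs) L t

  horner-scale : ∀ {n} k (cs : Vec ℚ n) L t →
                 horner (Vec.map (k *_) cs) (k * L) t ≡ k * horner cs L t
  horner-scale k []       L t = refl
  horner-scale k (c ∷ cs) L t = begin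
    k * c + t * horner (Vec.map (k *_) cs) (k * L) t ≡⟨ cong (λ h → k * c + t * h) (horner-scale k cs L t) ⟩
    k * c + t * (k * horner cs L t)                  ≡⟨ solve 4 (λ k c t h → k :* c :+ t :* (k :* h) :=
                                                                            k :* (c :+ t :* h))
                                                                refl k c t (horner cs L t) ⟩
    k * (c + t * horner cs L t)                      ∎

  horner-∷ʳ : ∀ {n} (cs : Vec ℚ n) c L t → horner (cs ∷ʳ c) L t ≡ horner cs (c + t * L) t
  horner-∷ʳ []        c L t = refl
  horner-∷ʳ (c′ ∷ cs) c L t = cong (λ h → c′ + t * h) (horner-∷ʳ cs c L t)

  yCoefficients : ℚ → (ℕ → ℚ) → (n : ℕ) → Vec ℚ (suc n)
  yCoefficients a₀ w zero    = a₀ ∷ []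
  yCoefficients a₀ w (suc n) = yCoefficients a₀ w n ∷ʳ w (suc n)

  horner-yCoefficients : ∀ a₀ w n L t →
                         horner (yCoefficients a₀ w n) L t ≡ a₀ + sumTW n w t + powℚ t (suc n) * L
  horner-yCoefficients a₀ w zero L t =
    solve 3 (λ a₀ t L → a₀ :+ t :* L := (a₀ :+ con 0ℚ) :+ (t :* con 1ℚ) :* L) refl a₀ t L
  horner-yCoefficients a₀ w (suc n) L t = begin
    horner (yCoefficients a₀ w n ∷ʳ wₙ) L t     ≡⟨ horner-∷ʳ (yCoefficients a₀ w n) wₙ L t ⟩
    horner (yCoefficients a₀ w n) (wₙ + t * L) t ≡⟨ horner-yCoefficients a₀ w n (wₙ + t * L) t ⟩
    a₀ + S + tⁿ * (wₙ + t * L)                   ≡⟨ solve 6 (λ a₀ S tⁿ wₙ t L →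
                                                       a₀ :+ S :+ tⁿ :* (wₙ :+ t :* L) :=
                                                       a₀ :+ (S :+ tⁿ :* wₙ) :+ (t :* tⁿ) :* L)
                                                     refl a₀ S tⁿ wₙ t L ⟩
    a₀ + (S + tⁿ * wₙ) + (t * tⁿ) * L            ∎
    where
    wₙ = w (suc n)
    S  = sumTW n w t
    tⁿ = powℚ t (suc n)

open Horner

module Spacing where
  open import Data.Rational using (_+_; _-_; _*_; ∣_∣; _≤_)
  open +-*-Solver

  Spaced : List ℚ → Set
  Spaced = Linked (λ s t → 1ℚ ≤ t - s)

  gap-+ : ∀ s s′ t {a b} → a ≤ s′ - s → b ≤ t - s′ → a + b ≤ t - s
  gap-+ s s′ t a≤ b≤ = ℚ.≤-trans (ℚ.+-mono-≤ a≤ b≤)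
    (ℚ.≤-reflexive (solve 3 (λ s s′ t → (s′ :- s) :+ (t :- s′) := t :- s) refl s s′ t))

  spaced⇒0≤gaps : ∀ {s ss} → Spaced (s ∷ ss) → All (λ t → 0ℚ ≤ t - s) (s ∷ ss)
  spaced⇒0≤gaps {s} sp =
    Linked.Linked⇒All (λ {r s t} → gap-+ r s t) (ℚ.≤-reflexive (sym (ℚ.+-inverseʳ s)))
      (Linked.map (ℚ.≤-trans (ℚ.nonNegative⁻¹ 1ℚ)) sp)

  spaced-drop : ∀ h {s ss} → Spaced (s ∷ ss) → All (λ t → ℕtoℚ h ≤ t - s) (drop h (s ∷ ss))
  spaced-drop zero    sp = spaced⇒0≤gaps sp
  spaced-drop (suc h) [-] = All.drop⁺ h []
  spaced-drop (suc h) {s} {s′ ∷ _} (1≤ ∷ sp) =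
    All.map (λ {t} h≤ → subst (_≤ t - s) (sym (ℕtoℚ-suc h)) (gap-+ s s′ t 1≤ h≤)) (spaced-drop h sp)

  integers-spaced : ∀ t₀ {zs} → Linked ℤ._<_ zs → Spaced (map (λ z → t₀ + ℤtoℚ z) zs)
  integers-spaced t₀ zs< = Linked.map⁺ (Linked.map shift zs<)
    where
    shift : ∀ {z z′} → z ℤ.< z′ → 1ℚ ≤ (t₀ + ℤtoℚ z′) - (t₀ + ℤtoℚ z)
    shift {z} {z′} z<z′ = subst (1ℚ ≤_)
      (solve 3 (λ t₀ a b → b :- a := (t₀ :+ b) :- (t₀ :+ a)) refl t₀ (ℤtoℚ z) (ℤtoℚ z′))
      (ℤtoℚ-<⇒1≤- z<z′)

  quotient-bound : ∀ {a b d q h M} → 0ℚ ≤ h → h ≤ d → a - b ≡ d * q → ∣ a ∣ ≤ M → ∣ b ∣ ≤ M →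
                   ∣ h * q ∣ ≤ M + M
  quotient-bound {a} {b} {d} {q} {h} {M} 0≤h h≤d a-b≡dq ∣a∣≤M ∣b∣≤M = begin
    ∣ h * q ∣     ≡⟨ ℚ.∣p*q∣≡∣p∣*∣q∣ h q ⟩
    ∣ h ∣ * ∣ q ∣ ≡⟨ cong (_* ∣ q ∣) (ℚ.0≤p⇒∣p∣≡p 0≤h) ⟩
    h * ∣ q ∣     ≤⟨ *-mono-≤-nonNeg 0≤h (ℚ.0≤∣p∣ q) h≤d ℚ.≤-refl ⟩
    d * ∣ q ∣     ≡⟨ cong (_* ∣ q ∣) (sym (ℚ.0≤p⇒∣p∣≡p (ℚ.≤-trans 0≤h h≤d))) ⟩
    ∣ d ∣ * ∣ q ∣ ≡⟨ sym (ℚ.∣p*q∣≡∣p∣*∣q∣ d q) ⟩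
    ∣ d * q ∣     ≡⟨ cong ∣_∣ (sym a-b≡dq) ⟩
    ∣ a - b ∣     ≤⟨ ℚ.∣p-q∣≤∣p∣+∣q∣ a b ⟩
    ∣ a ∣ + ∣ b ∣ ≤⟨ ℚ.+-mono-≤ ∣a∣≤M ∣b∣≤M ⟩
    M + M         ∎
    where open ℚ.≤-Reasoning

  leading-coefficient-bound : ∀ {n} (cs : Vec ℚ n) L M h T → Spaced T → n ℕ.* h ℕ.< length T →
                              All (λ t → ∣ horner cs L t ∣ ≤ M) T →
                              powℚ (ℕtoℚ h) n * ∣ L ∣ ≤ powℚ (ℕtoℚ 2) n * M
  leading-coefficient-bound [] L M h (_ ∷ _) _ _ (∣L∣≤M ∷ _) =
    subst₂ _≤_ (sym (ℚ.*-identityˡ ∣ L ∣)) (sym (ℚ.*-identityˡ M)) ∣L∣≤M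
  leading-coefficient-bound {suc n} (c ∷ cs) L M h T@(s ∷ _) sp n*h<N bounds = begin
    powℚ H (suc n) * ∣ L ∣
      ≡⟨ solve 3 (λ H Hⁿ l → (H :* Hⁿ) :* l := Hⁿ :* (H :* l)) refl H (powℚ H n) ∣ L ∣ ⟩
    powℚ H n * (H * ∣ L ∣)
      ≡⟨ cong (λ x → powℚ H n * (x * ∣ L ∣)) (sym (ℚ.0≤p⇒∣p∣≡p (0≤ℕtoℚ h))) ⟩
    powℚ H n * (∣ H ∣ * ∣ L ∣)
      ≡⟨ cong (powℚ H n *_) (sym (ℚ.∣p*q∣≡∣p∣*∣q∣ H L)) ⟩
    powℚ H n * ∣ H * L ∣
      ≤⟨ leading-coefficient-bound Q (H * L) (M + M) h (drop h T) (Linked-drop⁺ h sp) far-count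
           (All.zipWith (λ (h≤ , bound) → far-bound h≤ bound) (spaced-drop h sp , All.drop⁺ h bounds)) ⟩
    powℚ (ℕtoℚ 2) n * (M + M)
      ≡⟨ solve 2 (λ p M → p :* (M :+ M) := (con (ℕtoℚ 2) :* p) :* M) refl (powℚ (ℕtoℚ 2) n) M ⟩
    powℚ (ℕtoℚ 2) (suc n) * M ∎
    where
    open ℚ.≤-Reasoning
    H = ℕtoℚ h
    Q = Vec.map (H *_) (quotient s L cs)
    far-count : n ℕ.* h ℕ.< length (drop h T)
    far-count = subst (n ℕ.* h ℕ.<_) (sym (length-drop h T)) (ℕ.m+n≤o⇒m≤o∸n (suc (n ℕ.* h))
      (subst (ℕ._≤ length T) (cong suc (ℕ.+-comm h (n ℕ.* h))) n*h<N))
    far-bound : ∀ {t} → H ≤ t - s → ∣ horner (c ∷ cs) L t ∣ ≤ M → ∣ horner Q (H * L) t ∣ ≤ M + M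
    far-bound {t} h≤t-s ∣Ht∣≤M = subst (λ x → ∣ x ∣ ≤ M + M) (sym (horner-scale H (quotient s L cs) L t))
      (quotient-bound (0≤ℕtoℚ h) h≤t-s (horner-factor c cs L s t) ∣Ht∣≤M (All.head bounds))

  spaced-count-bound : ∀ {n} e → suc n ℕ.≤ e → ∀ (cs : Vec ℚ (suc n)) L M T → 0ℚ ≤ M → Spaced T →
                       All (λ t → ∣ horner cs L t ∣ ≤ M) T →
                       powℚ (ℕtoℚ (length T ℕ.∸ e)) (suc n) * ∣ L ∣ ≤ powℚ (ℕtoℚ (2 ℕ.* e)) (suc n) * M
  spaced-count-bound {n} (suc e) _ cs L M [] 0≤M _ _ = begin
    powℚ 0ℚ (suc n) * ∣ L ∣               ≡⟨ cong (_* ∣ L ∣) (ℚ.*-zeroˡ (powℚ 0ℚ n)) ⟩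
    0ℚ * ∣ L ∣                            ≡⟨ ℚ.*-zeroˡ ∣ L ∣ ⟩
    0ℚ                                    ≤⟨ *-nonNeg (powℚ-nonNeg (suc n) (0≤ℕtoℚ (2 ℕ.* suc e))) 0≤M ⟩
    powℚ (ℕtoℚ (2 ℕ.* suc e)) (suc n) * M ∎
    where open ℚ.≤-Reasoning
  spaced-count-bound {n} e d≤e cs L M T@(_ ∷ ss) 0≤M sp bounds = begin
    powℚ (ℕtoℚ (length T ℕ.∸ e)) d * ∣ L ∣
      ≤⟨ *-mono-≤-nonNeg (powℚ-nonNeg d 0≤k) (ℚ.0≤∣p∣ L) (powℚ-mono-≤ d 0≤k (ℕtoℚ-mono-≤ N∸e≤d*h)) ℚ.≤-refl ⟩
    powℚ (ℕtoℚ (d ℕ.* h)) d * ∣ L ∣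
      ≡⟨ cong (λ x → powℚ x d * ∣ L ∣) (ℕtoℚ-* d h) ⟩
    powℚ (D * H) d * ∣ L ∣
      ≡⟨ cong (_* ∣ L ∣) (powℚ-distrib-* D H d) ⟩
    (powℚ D d * powℚ H d) * ∣ L ∣
      ≡⟨ ℚ.*-assoc (powℚ D d) (powℚ H d) ∣ L ∣ ⟩
    powℚ D d * (powℚ H d * ∣ L ∣)
      ≤⟨ *-mono-≤-nonNeg (powℚ-nonNeg d (0≤ℕtoℚ d)) (*-nonNeg (powℚ-nonNeg d (0≤ℕtoℚ h)) (ℚ.0≤∣p∣ L))
           ℚ.≤-refl (leading-coefficient-bound cs L M h T sp d*h<N bounds) ⟩
    powℚ D d * (powℚ (ℕtoℚ 2) d * M)
      ≡⟨ solve 3 (λ a b M → a :* (b :* M) := (b :* a) :* M) refl (powℚ D d) (powℚ (ℕtoℚ 2) d) M ⟩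
    (powℚ (ℕtoℚ 2) d * powℚ D d) * M
      ≡⟨ cong (_* M) (sym (powℚ-distrib-* (ℕtoℚ 2) D d)) ⟩
    powℚ (ℕtoℚ 2 * D) d * M
      ≡⟨ cong (λ x → powℚ x d * M) (sym (ℕtoℚ-* 2 d)) ⟩
    powℚ (ℕtoℚ (2 ℕ.* d)) d * M
      ≤⟨ *-mono-≤-nonNeg (powℚ-nonNeg d 0≤2d) 0≤M
           (powℚ-mono-≤ d 0≤2d (ℕtoℚ-mono-≤ (ℕ.*-monoʳ-≤ 2 d≤e))) ℚ.≤-refl ⟩
    powℚ (ℕtoℚ (2 ℕ.* e)) d * M ∎
    where
    open ℚ.≤-Reasoning
    d = suc n
    -- the largest h with d h < length T
    h = length ss / d
    D = ℕtoℚ d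
    H = ℕtoℚ h
    0≤k = 0≤ℕtoℚ (length T ℕ.∸ e)
    0≤2d = 0≤ℕtoℚ (2 ℕ.* d)
    d*h<N : d ℕ.* h ℕ.< length T
    d*h<N = ℕ.s≤s (subst (ℕ._≤ length ss) (ℕ.*-comm h d) (m/n*n≤m (length ss) d))
    N∸e≤d*h : length T ℕ.∸ e ℕ.≤ d ℕ.* h
    N∸e≤d*h = ℕ.≤-trans (ℕ.∸-monoʳ-≤ (length T) d≤e)
      (subst (length T ℕ.∸ d ℕ.≤_) (ℕ.*-comm h d) (suc[m]∸n≤m/n*n (length ss) d))

open Spacing

module Line (n : ℕ) (a₀ a₁ a₂ : ℚ) (w : ℕ → ℚ) (wₑ v₁ v₂ : ℤ) (B : ℚ) where
  open import Data.Rational using (_+_; _-_; _*_; ∣_∣; _≤_)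
  open +-*-Solver

  e : ℕ
  e = suc n

  OnLineAt : ℚ → ℤ × ℤ × ℤ → Set
  OnLineAt t (y , x₁ , x₂) =
    ℤtoℚ y ≡ yCoord e a₀ w wₑ t × ℤtoℚ x₁ ≡ xCoord a₁ v₁ t × ℤtoℚ x₂ ≡ xCoord a₂ v₂ t

  InBoxAt : ℚ → Set
  InBoxAt t = ∣ yCoord e a₀ w wₑ t ∣ ≤ powℚ B e × ∣ xCoord a₁ v₁ t ∣ ≤ B × ∣ xCoord a₂ v₂ t ∣ ≤ B

  inBoxAt : ∀ {t p} → OnLineAt t p → InBox e B p → InBoxAt t
  inBoxAt (y≡ , x₁≡ , x₂≡) (∣y∣≤ , ∣x₁∣≤ , ∣x₂∣≤) =
    subst (λ q → ∣ q ∣ ≤ powℚ B e) y≡ ∣y∣≤ , subst (λ q → ∣ q ∣ ≤ B) x₁≡ ∣x₁∣≤ , subst (λ q → ∣ q ∣ ≤ B) x₂≡ ∣x₂∣≤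

  onLineAt-injective : ∀ {t p q} → OnLineAt t p → OnLineAt t q → p ≡ q
  onLineAt-injective (y≡ , x₁≡ , x₂≡) (y′≡ , x₁′≡ , x₂′≡) =
    cong₂ _,_ (ℤtoℚ-injective (trans y≡ (sym y′≡)))
      (cong₂ _,_ (ℤtoℚ-injective (trans x₁≡ (sym x₁′≡))) (ℤtoℚ-injective (trans x₂≡ (sym x₂′≡))))

  offset : ℤ → ℤ → ℤ × ℤ × ℤ → ℤ × ℤ × ℤ → ℤ
  offset α β (_ , x₁₀ , x₂₀) (_ , x₁ , x₂) = α ℤ.* (x₁ ℤ.- x₁₀) ℤ.+ β ℤ.* (x₂ ℤ.- x₂₀)

  parameter-offset : ∀ α β {t₀ t} p₀ p → α ℤ.* v₁ ℤ.+ β ℤ.* v₂ ≡ 1ℤ → OnLineAt t₀ p₀ → OnLineAt t p →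
                     t ≡ t₀ + ℤtoℚ (offset α β p₀ p)
  parameter-offset α β {t₀} {t} (_ , x₁₀ , x₂₀) (_ , x₁ , x₂) bez (_ , x₁₀≡ , x₂₀≡) (_ , x₁≡ , x₂≡) = begin
    t             ≡⟨ solve 2 (λ t₀ t → t := t₀ :+ (t :- t₀)) refl t₀ t ⟩
    t₀ + (t - t₀) ≡⟨ cong (_+_ t₀) (bézout-integral α β v₁ v₂ (x₁ ℤ.- x₁₀) (x₂ ℤ.- x₂₀) bez
                                      (x-difference a₁ v₁ x₁ x₁₀ x₁≡ x₁₀≡)
                                      (x-difference a₂ v₂ x₂ x₂₀ x₂≡ x₂₀≡)) ⟩
    t₀ + ℤtoℚ (α ℤ.* (x₁ ℤ.- x₁₀) ℤ.+ β ℤ.* (x₂ ℤ.- x₂₀)) ∎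
    where
    open ≡.≡-Reasoning
    x-difference : ∀ a v x x′ → ℤtoℚ x ≡ xCoord a v t → ℤtoℚ x′ ≡ xCoord a v t₀ →
                   ℤtoℚ (x ℤ.- x′) ≡ (t - t₀) * ℤtoℚ v
    x-difference a v x x′ x≡ x′≡ = begin
      ℤtoℚ (x ℤ.- x′)                      ≡⟨ ℤtoℚ-- x x′ ⟩
      ℤtoℚ x - ℤtoℚ x′                     ≡⟨ cong₂ _-_ x≡ x′≡ ⟩
      (a + t * ℤtoℚ v) - (a + t₀ * ℤtoℚ v) ≡⟨ solve 4 (λ a t t₀ V → (a :+ t :* V) :- (a :+ t₀ :* V) :=
                                                                     (t :- t₀) :* V)
                                                       refl a t t₀ (ℤtoℚ v) ⟩
      (t - t₀) * ℤtoℚ v                    ∎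

  spaced-parameters : ∀ α β → α ℤ.* v₁ ℤ.+ β ℤ.* v₂ ≡ 1ℤ → ∀ pts → Unique pts →
                      All (λ p → OnLine e a₀ a₁ a₂ w wₑ v₁ v₂ p × InBox e B p) pts →
                      ∃ λ T → Spaced T × length T ≡ length pts × All InBoxAt T
  spaced-parameters _ _ _ [] _ [] = [] , [] , refl , []
  spaced-parameters α β bez pts@(p₀ ∷ _) unique onBox@(((t₀ , on₀) , _) ∷ _) =
    T , integers-spaced t₀ (sort-strictlyIncreasing offsets-unique) , length-T , boxes
    where
    Z = map (offset α β p₀) pts
    T = map (λ z → t₀ + ℤtoℚ z) (sort Z)
    parameter : ∀ {t p} → OnLineAt t p → t ≡ t₀ + ℤtoℚ (offset α β p₀ p)
    parameter {p = p} = parameter-offset α β p₀ p bez on₀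
    offset-injective : ∀ {p q} → OnLine e a₀ a₁ a₂ w wₑ v₁ v₂ p → OnLine e a₀ a₁ a₂ w wₑ v₁ v₂ q →
                       offset α β p₀ p ≡ offset α β p₀ q → p ≡ q
    offset-injective {p} {q} (t , on) (t′ , on′) eq =
      onLineAt-injective {p = p} {q} on (subst (λ s → OnLineAt s q) t′≡t on′)
      where
      t′≡t = trans (parameter {p = q} on′)
               (trans (cong (λ z → t₀ + ℤtoℚ z) (sym eq)) (sym (parameter {p = p} on)))
    offsets-unique : Unique Z
    offsets-unique = Unique-map⁺-on offset-injective (All.map proj₁ onBox) unique
    length-T : length T ≡ length pts
    length-T = trans (length-map _ (sort Z)) (trans (↭-length (sort-↭ Z)) (length-map _ pts))
    boxes : All InBoxAt T
    boxes = All.map⁺ (All-resp-↭ (↭-sym (sort-↭ Z)) (All.map⁺ (All.map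
      (λ {p} ((t , on) , box) → subst InBoxAt (parameter {p = p} on) (inBoxAt {p = p} on box)) onBox)))

  count-bound : ∀ {T} → 0ℚ ≤ B → Spaced T → All InBoxAt T → CountBound e B wₑ v₁ v₂ (length T)
  count-bound {T} 0≤B spaced boxes =
    x-bound a₁ v₁ (All.map (proj₁ ∘ proj₂) boxes) , x-bound a₂ v₂ (All.map (proj₂ ∘ proj₂) boxes) , y-bound
    where
    N∸e = ℕtoℚ (length T ℕ.∸ e)
    x-bound : ∀ a v → All (λ t → ∣ xCoord a v t ∣ ≤ B) T → N∸e * ∣ ℤtoℚ v ∣ ≤ ℕtoℚ (2 ℕ.* e) * B
    x-bound a v bounds =
      subst₂ _≤_ (cong (_* ∣ ℤtoℚ v ∣) (ℚ.*-identityʳ N∸e)) (cong (_* B) (ℚ.*-identityʳ (ℕtoℚ (2 ℕ.* e))))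
        (spaced-count-bound e (ℕ.s≤s ℕ.z≤n) (a ∷ []) (ℤtoℚ v) B T 0≤B spaced bounds)
    y-bound : powℚ N∸e e * ∣ ℤtoℚ wₑ ∣ ≤ powℚ (ℕtoℚ (2 ℕ.* e) * B) e
    y-bound = subst (powℚ N∸e e * ∣ ℤtoℚ wₑ ∣ ≤_) (sym (powℚ-distrib-* (ℕtoℚ (2 ℕ.* e)) B e))
      (spaced-count-bound e ℕ.≤-refl (yCoefficients a₀ w n) (ℤtoℚ wₑ) (powℚ B e) T (powℚ-nonNeg e 0≤B) spaced
        (All.map (λ {t} box → subst (λ q → ∣ q ∣ ≤ powℚ B e)
                                    (sym (horner-yCoefficients a₀ w n (ℤtoℚ wₑ) t)) (proj₁ box)) boxes))

open import Data.Nat using (_≤_; _<_; _+_; _*_)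

lemma4p3 : (d e : ℕ) → 2 ≤ d → 1 ≤ e →
    (f : ℕ → Poly2 ℤ) → (∀ i → 1 ≤ i → i ≤ d → HomogOfDeg (e * i) (f i)) →
    AbsIrreducible (Ftop d f) →
    (F₀ : Poly3 ℤ) → All (λ m → e * degY m + deg1 m + deg2 m < d * e) F₀ →
    (a₀ a₁ a₂ : ℚ) (w : ℕ → ℚ) (wₑ v₁ v₂ : ℤ) → Coprime v₁ v₂ →
    (∀ t → evalℤ3 (Ftop d f ++ F₀) (yCoord e a₀ w wₑ t) (xCoord a₁ v₁ t) (xCoord a₂ v₂ t) ≡ 0ℚ) →
    (B : ℚ) → 1ℚ Data.Rational.≤ B →
    (pts : List (ℤ × ℤ × ℤ)) → Unique pts →
    All (λ p → OnLine e a₀ a₁ a₂ w wₑ v₁ v₂ p × InBox e B p) pts →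
    CountBound e B wₑ v₁ v₂ (length pts)
lemma4p3 _ (suc n) _ _ _ _ _ _ _ a₀ a₁ a₂ w wₑ v₁ v₂ coprime _ B 1≤B pts unique onBox =
  let α , β , bez = bézout {v₁} {v₂} coprime
      T , spaced , length-T , boxes = spaced-parameters α β bez pts unique onBox
  in subst (CountBound (suc n) B wₑ v₁ v₂) length-T (count-bound 0≤B spaced boxes)
  where
  open Line n a₀ a₁ a₂ w wₑ v₁ v₂ B
  0≤B : 0ℚ Data.Rational.≤ B
  0≤B = ℚ.≤-trans (ℚ.nonNegative⁻¹ 1ℚ) 1≤B
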